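{- Let $a,b,n$ be natural numbers with $b<a<n$, and let $s$ be an integer with $0<s<n$ such that $as+b(n-s)$ is even. Then the sequence $(a^s,b^{n-s})$ (that is, $a$ repeated $s$ times followed by $b$ repeated $n-s$ times) is graphic if and only if \[ s^2-(1+a+b)s+nb\geq 0. \]
   Context: A finite sequence of integers is called graphic if it is the sequence of vertex degrees of some finite simple graph. In the notation $(a^s,b^{n-s})$, superscripts denote the number of repetitions of the entry. -}

module Defs where

open import Data.Nat using (ℕ; _∸_)
open import Data.Bool using (Bool; true; false; if_then_else_)
open import Data.Fin using (Fin; toℕ)
open import Data.Nat using (_<ᵇ_)
open import Data.List using (List; length; filter; allFin)
open import Data.Vec using (Vec; lookup; replicate; _++_)
open import Data.Product using (Σ; _×_)
open import Relation.Binary.PropositionalEquality using (_≡_)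
open import Relation.Nullary using (¬_)
open import Data.Bool.Properties using (T?)

record SimpleGraph (n : ℕ) : Set where
  field
    adj     : Fin n → Fin n → Bool
    symm    : ∀ i j → adj i j ≡ adj j i
    irrefl  : ∀ i → adj i i ≡ false

open SimpleGraph public

degree : ∀ {n} → SimpleGraph n → Fin n → ℕ
degree {n} G i = length (filter (λ j → T? (adj G i j)) (allFin n))

Graphic : ∀ {n} → Vec ℕ n → Set
Graphic {n} d = Σ (SimpleGraph n) (λ G → ∀ i → degree G i ≡ lookup d i)

twoValued : (a b s n : ℕ) → Vec ℕ (s Data.Nat.+ (n ∸ s))
twoValued a b s n = replicate s a ++ replicate (n ∸ s) b

module Submission where

-- Necessity is the Erdős–Gallai inequality for the s vertices of degree a: among
-- themselves they span at most s(s − 1) edge ends, and every other edge end at them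
-- comes from one of the n − s vertices of degree b, so s·a ≤ s(s − 1) + (n − s)·b.
--
-- For sufficiency the graph is glued from a graph on the first s vertices, a graph on
-- the last n − s vertices and a bipartite graph between the two blocks, all with
-- near-regular degrees (two consecutive values). A near-regular sequence with even sum
-- and maximum below the number of vertices is graphic: join a vertex of maximum degree
-- to a cyclic block of the others and recurse, as in Havel–Hakimi. Bipartite graphs with
-- near-regular column degrees are filled row by row the same way. What remains is the
-- number of crossing edges: s·a (no edges inside the first block), (n − s)·b (none
-- inside the second), or s(n − s), minus one if parity demands it; the inequality of the
-- theorem is exactly what makes one of these choices admissible.

open import Defs
open import Algebra.Properties.CommutativeSemigroup using (interchange)
open import Data.Bool using (Bool; true; false; not; _∧_; _∨_; if_then_else_)
open import Data.Bool.Properties using (T-≡; T?)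
open import Data.Empty using (⊥-elim)
open import Data.Fin using (Fin; toℕ; fromℕ<) renaming (zero to fzero; suc to fsuc)
open import Data.Fin.Properties using (toℕ-fromℕ<; toℕ<n)
open import Data.List using (length; filter; tabulate; _∷_; [])
open import Data.Nat
open import Data.Nat.DivMod using (_/_; _%_; m%n<n; m≡m%n+[m/n]*n)
open import Data.Nat.Divisibility using (_∣_; divides)
open import Data.Nat.Properties
open import Data.Nat.Tactic.RingSolver using (solve)
open import Data.Parity.Base using (0ℙ; 1ℙ; _⁻¹)
import Data.Parity.Base as ℙ
import Data.Parity.Properties as ℙₚ
open import Data.Product using (Σ; _×_; _,_; proj₁; proj₂)
open import Data.Sum using (_⊎_; inj₁; inj₂)
open import Data.Vec using (Vec; lookup; replicate; _++_)
open import Data.Vec.Properties using (lookup-replicate)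
open import Function using (_∘_; id; Equivalence; _⇔_; mk⇔)
open import Relation.Binary.PropositionalEquality
open import Relation.Nullary using (yes; no; contradiction)

bit : Bool → ℕ
bit true = 1
bit false = 0

∑ : ℕ → (ℕ → ℕ) → ℕ
∑ zero f = 0
∑ (suc N) f = f 0 + ∑ N (f ∘ suc)

count : ℕ → (ℕ → Bool) → ℕ
count N P = ∑ N (bit ∘ P)

∑-cong : ∀ N {f g : ℕ → ℕ} → (∀ x → x < N → f x ≡ g x) → ∑ N f ≡ ∑ N g
∑-cong zero e = refl
∑-cong (suc N) e = cong₂ _+_ (e 0 z<s) (∑-cong N (λ x x<N → e (suc x) (s<s x<N)))

count-cong : ∀ N {P Q : ℕ → Bool} → (∀ x → x < N → P x ≡ Q x) → count N P ≡ count N Q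
count-cong N e = ∑-cong N (λ x x<N → cong bit (e x x<N))

∑-mono-≤ : ∀ N {f g : ℕ → ℕ} → (∀ x → x < N → f x ≤ g x) → ∑ N f ≤ ∑ N g
∑-mono-≤ zero e = z≤n
∑-mono-≤ (suc N) e = +-mono-≤ (e 0 z<s) (∑-mono-≤ N (λ x x<N → e (suc x) (s<s x<N)))

∑-distrib-+ : ∀ N f g → ∑ N (λ x → f x + g x) ≡ ∑ N f + ∑ N g
∑-distrib-+ zero f g = refl
∑-distrib-+ (suc N) f g =
  trans (cong (f 0 + g 0 +_) (∑-distrib-+ N (f ∘ suc) (g ∘ suc)))
        (interchange +-commutativeSemigroup (f 0) (g 0) _ _)

∑-const : ∀ N c → ∑ N (λ _ → c) ≡ N * c
∑-const zero c = refl
∑-const (suc N) c = cong (c +_) (∑-const N c)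

∑-∸ : ∀ N c f → (∀ x → x < N → f x ≤ c) → ∑ N (λ x → c ∸ f x) + ∑ N f ≡ N * c
∑-∸ N c f f≤c =
  trans (sym (∑-distrib-+ N _ f)) (trans (∑-cong N (λ x x<N → m∸n+n≡m (f≤c x x<N))) (∑-const N c))

∑-++ : ∀ s m f → ∑ (s + m) f ≡ ∑ s f + ∑ m (λ z → f (s + z))
∑-++ zero m f = refl
∑-++ (suc s) m f = trans (cong (f 0 +_) (∑-++ s m (f ∘ suc))) (sym (+-assoc (f 0) _ _))

∑-comm : ∀ s m (F : ℕ → ℕ → ℕ) → ∑ s (λ x → ∑ m (F x)) ≡ ∑ m (λ z → ∑ s (λ x → F x z))
∑-comm zero m F = sym (trans (∑-const m 0) (*-zeroʳ m))
∑-comm (suc s) m F =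
  trans (cong (∑ m (F 0) +_) (∑-comm s m (F ∘ suc))) (sym (∑-distrib-+ m (F 0) _))

∑-snoc : ∀ N f → ∑ (suc N) f ≡ ∑ N f + f N
∑-snoc zero f = +-identityʳ (f 0)
∑-snoc (suc N) f = trans (cong (f 0 +_) (∑-snoc N (f ∘ suc))) (sym (+-assoc (f 0) _ _))

∑-reverse : ∀ N f → ∑ N (λ x → f (N ∸ suc x)) ≡ ∑ N f
∑-reverse zero f = refl
∑-reverse (suc N) f =
  trans (cong (f N +_) (∑-reverse N f)) (trans (+-comm (f N) _) (sym (∑-snoc N f)))

∑≡0⇒≡0 : ∀ N f → ∑ N f ≡ 0 → ∀ x → x < N → f x ≡ 0
∑≡0⇒≡0 (suc N) f e zero _ = m+n≡0⇒m≡0 (f 0) e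
∑≡0⇒≡0 (suc N) f e (suc x) (s<s x<N) = ∑≡0⇒≡0 N (f ∘ suc) (m+n≡0⇒n≡0 (f 0) e) x x<N

<ᵇ-true : ∀ {x p} → x < p → (x <ᵇ p) ≡ true
<ᵇ-true x<p = Equivalence.to T-≡ (<⇒<ᵇ x<p)

<ᵇ-false : ∀ {x p} → p ≤ x → (x <ᵇ p) ≡ false
<ᵇ-false {x} {p} p≤x with x <ᵇ p in eq
... | false = refl
... | true  = ⊥-elim (≤⇒≯ p≤x (<ᵇ⇒< x p (Equivalence.from T-≡ eq)))

<ᵇ-mono : ∀ {x lo hi} → lo ≤ hi → (x <ᵇ lo) ≡ true → (x <ᵇ hi) ≡ true
<ᵇ-mono {x} {lo} lo≤hi eq = <ᵇ-true (≤-trans (<ᵇ⇒< x lo (Equivalence.from T-≡ eq)) lo≤hi)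

count≤ : ∀ N P → count N P ≤ N
count≤ zero P = z≤n
count≤ (suc N) P with P 0
... | true  = s≤s (count≤ N (P ∘ suc))
... | false = m≤n⇒m≤1+n (count≤ N (P ∘ suc))

count<ᵇ : ∀ N u → u ≤ N → count N (_<ᵇ u) ≡ u
count<ᵇ N zero _ = trans (∑-const N 0) (*-zeroʳ N)
count<ᵇ (suc N) (suc u) (s≤s u≤N) = cong suc (count<ᵇ N u u≤N)

count-∧-not : ∀ N {P Q : ℕ → Bool} → (∀ x → P x ≡ true → Q x ≡ true) →
              count N (λ x → Q x ∧ not (P x)) + count N P ≡ count N Q
count-∧-not N {P} {Q} P⇒Q =
  trans (sym (∑-distrib-+ N _ _)) (∑-cong N (λ x _ → pointwise (P x) (Q x) (P⇒Q x)))
  where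
  pointwise : ∀ p q → (p ≡ true → q ≡ true) → bit (q ∧ not p) + bit p ≡ bit q
  pointwise true  q     p⇒q = subst (λ q → bit (q ∧ false) + 1 ≡ bit q) (sym (p⇒q refl)) refl
  pointwise false true  _   = refl
  pointwise false false _   = refl

count-∨-not : ∀ N {P Q : ℕ → Bool} → (∀ x → P x ≡ true → Q x ≡ true) →
              count N (λ x → P x ∨ not (Q x)) + count N Q ≡ count N P + N
count-∨-not N {P} {Q} P⇒Q = begin
  count N (λ x → P x ∨ not (Q x)) + count N Q ≡⟨ ∑-distrib-+ N _ _ ⟨
  ∑ N (λ x → bit (P x ∨ not (Q x)) + bit (Q x)) ≡⟨ ∑-cong N (λ x _ → pointwise (P x) (Q x) (P⇒Q x)) ⟩
  ∑ N (λ x → bit (P x) + 1)                     ≡⟨ ∑-distrib-+ N _ _ ⟩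
  count N P + ∑ N (λ _ → 1)                     ≡⟨ cong (count N P +_) (trans (∑-const N 1) (*-identityʳ N)) ⟩
  count N P + N                                 ∎
  where
  open ≡-Reasoning
  pointwise : ∀ p q → (p ≡ true → q ≡ true) → bit (p ∨ not q) + bit q ≡ bit p + 1
  pointwise true  q     p⇒q = subst (λ q → 1 + bit q ≡ 2) (sym (p⇒q refl)) refl
  pointwise false true  _   = refl
  pointwise false false _   = refl

count<-gap : ∀ N P x → x < N → P x ≡ false → count N P < N
count<-gap (suc N) P zero _ P0 rewrite P0 = s≤s (count≤ N (P ∘ suc))
count<-gap (suc N) P (suc x) (s<s x<N) Px with P 0
... | true  = s<s (count<-gap N (P ∘ suc) x x<N Px)
... | false = m<n⇒m<1+n (count<-gap N (P ∘ suc) x x<N Px)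

parity-double+ : ∀ c x → parity (c + c + x) ≡ parity x
parity-double+ c x =
  trans (ℙₚ.+-homo-+ (c + c) x)
        (cong (ℙ._+ parity x) (trans (ℙₚ.+-homo-+ c c) (ℙₚ.p+p≡0ℙ (parity c))))

parity-suc*self : ∀ n → parity (suc n * n) ≡ 0ℙ
parity-suc*self n =
  trans (ℙₚ.*-homo-* (suc n) n) (trans (cong (ℙ._* parity n) parity-suc) (ℙₚ.p⁻¹*p≡0ℙ (parity n)))
  where
  parity-suc : parity (suc n) ≡ parity n ⁻¹
  parity-suc = trans (sym (ℙₚ.⁻¹-involutive _)) (cong _⁻¹ (ℙₚ.suc-homo-⁻¹ n))

2∣⇒parity≡0ℙ : ∀ {x} → 2 ∣ x → parity x ≡ 0ℙ
2∣⇒parity≡0ℙ (divides k refl) = trans (ℙₚ.*-homo-* k 2) (ℙₚ.*-zeroʳ (parity k))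

even-sum⇒parity≡ : ∀ x y → parity (x + y) ≡ 0ℙ → parity y ≡ parity x
even-sum⇒parity≡ x y even = ℙₚ.+-cancelˡ-≡ (parity x) _ _
  (trans (trans (sym (ℙₚ.+-homo-+ x y)) even) (sym (ℙₚ.p+p≡0ℙ (parity x))))

parity-odd+1 : ∀ x → parity x ≡ 1ℙ → parity (x + 1) ≡ 0ℙ
parity-odd+1 x odd = trans (ℙₚ.+-homo-+ x 1) (cong (ℙ._+ 1ℙ) odd)

-- Near-regular degree profiles

nearRegular : ℕ → ℕ → ℕ → ℕ
nearRegular k p x = if x <ᵇ p then suc k else k

k≤nearRegular : ∀ k p x → k ≤ nearRegular k p x
k≤nearRegular k p x with x <ᵇ p
... | true  = n≤1+n k
... | false = ≤-refl

nearRegular-≤ : ∀ {N k p c} → 0 < N → N * k + p ≤ N * c → ∀ x → nearRegular k p x ≤ c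
nearRegular-≤ {N} {k} {p} {c} 0<N total x with x <ᵇ p in x<ᵇp
... | false = *-cancelˡ-≤ N {{>-nonZero 0<N}} (≤-trans (m≤m+n (N * k) p) total)
... | true  = *-cancelˡ-< N k c (≤-trans (m<m+n (N * k) 0<p) total)
  where
  0<p : 0 < p
  0<p = ≤-trans (s≤s z≤n) (<ᵇ⇒< x p (Equivalence.from T-≡ x<ᵇp))

∸nearRegular-≤ : ∀ {N a c k p} → p < N → N * a ≤ N * c + (N * k + p) → ∀ x → a ∸ nearRegular k p x ≤ c
∸nearRegular-≤ {N} {a} {c} {k} {p} p<N total x =
  m≤n+o⇒m∸n≤o a (nearRegular k p x) (≤-trans a≤k+c (+-monoˡ-≤ c (k≤nearRegular k p x)))
  where
  a≤k+c : a ≤ k + c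
  a≤k+c = ≤-pred (*-cancelˡ-< N a (suc (k + c)) (begin-strict
    N * a                 ≤⟨ total ⟩
    N * c + (N * k + p)   <⟨ +-monoʳ-< (N * c) (+-monoʳ-< (N * k) p<N) ⟩
    N * c + (N * k + N)   ≡⟨ solve (N ∷ c ∷ k ∷ []) ⟩
    N * suc (k + c)       ∎))
    where open ≤-Reasoning

nearRegular-max : ∀ {N k p} → 0 < N → N * k + p + N ≤ N * N → nearRegular k p 0 ≤ pred N
nearRegular-max {suc n} {k} {p} 0<N total =
  nearRegular-≤ {k = k} {p} 0<N (+-cancelʳ-≤ (suc n) _ _ (≤-trans total (≤-reflexive N*N≡N*n+N))) 0
  where
  N*N≡N*n+N : suc n * suc n ≡ suc n * n + suc n
  N*N≡N*n+N = trans (*-suc (suc n) n) (+-comm (suc n) _)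

nearRegular-suc : ∀ k p x → nearRegular k (pred p) x ≡ nearRegular k p (suc x)
nearRegular-suc k zero    x = refl
nearRegular-suc k (suc p) x = refl

nearRegular-reverse : ∀ m k y r z → r ≤ m → z < m →
                      nearRegular k (m ∸ r) (m ∸ suc z) ≡ (y + suc k) ∸ nearRegular y r z
nearRegular-reverse m k y r z r≤m z<m with z <? r
... | yes z<r rewrite <ᵇ-false (∸-monoʳ-≤ m z<r) | <ᵇ-true z<r =
  sym (trans (cong (_∸ suc y) (+-suc y k)) (m+n∸m≡n (suc y) k))
... | no z≮r rewrite <ᵇ-true (∸-monoʳ-< (s≤s (≮⇒≥ z≮r)) z<m) | <ᵇ-false (≮⇒≥ z≮r) =
  sym (m+n∸m≡n y (suc k))

∑-nearRegular : ∀ N k p → p ≤ N → ∑ N (nearRegular k p) ≡ N * k + p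
∑-nearRegular N k p p≤N = begin
  ∑ N (nearRegular k p)                ≡⟨ ∑-cong N (λ x _ → split x) ⟩
  ∑ N (λ x → k + bit (x <ᵇ p))         ≡⟨ ∑-distrib-+ N _ _ ⟩
  ∑ N (λ _ → k) + count N (_<ᵇ p)      ≡⟨ cong₂ _+_ (∑-const N k) (count<ᵇ N p p≤N) ⟩
  N * k + p                            ∎
  where
  open ≡-Reasoning
  split : ∀ x → nearRegular k p x ≡ k + bit (x <ᵇ p)
  split x with x <ᵇ p
  ... | true  = sym (+-comm k 1)
  ... | false = sym (+-identityʳ k)

division : ∀ N T → 0 < N → Σ ℕ λ k → Σ ℕ λ p → p < N × N * k + p ≡ T
division (suc n) T _ = T / suc n , T % suc n , m%n<n T (suc n) ,
  trans (cong (_+ T % suc n) (*-comm (suc n) (T / suc n)))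
        (trans (+-comm (T / suc n * suc n) _) (sym (m≡m%n+[m/n]*n T (suc n))))

record Removal (N : ℕ) (f : ℕ → ℕ) (d : ℕ) (g : ℕ → ℕ) : Set where
  field
    block      : ℕ → Bool
    block-size : count N block ≡ d
    remove     : ∀ x → bit (block x) + g x ≡ f x

open Removal public

removal-∑ : ∀ {N f d g} → Removal N f d g → ∑ N f ≡ d + ∑ N g
removal-∑ {N} {f} {d} {g} R = begin
  ∑ N f                                ≡⟨ ∑-cong N (λ x _ → remove R x) ⟨
  ∑ N (λ x → bit (block R x) + g x)    ≡⟨ ∑-distrib-+ N _ g ⟩
  count N (block R) + ∑ N g            ≡⟨ cong (_+ ∑ N g) (block-size R) ⟩
  d + ∑ N g                            ∎
  where open ≡-Reasoning

interval-remove : ∀ k {lo hi} → lo ≤ hi → ∀ x →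
                  bit ((x <ᵇ hi) ∧ not (x <ᵇ lo)) + nearRegular k lo x ≡ nearRegular k hi x
interval-remove k {lo} {hi} lo≤hi x with x <ᵇ lo in x<lo | x <ᵇ hi in x<hi
... | true  | true  = refl
... | true  | false = contradiction (trans (sym (<ᵇ-mono lo≤hi x<lo)) x<hi) λ ()
... | false | true  = refl
... | false | false = refl

cointerval-remove : ∀ k {lo hi} → lo ≤ hi → ∀ x →
                    bit ((x <ᵇ lo) ∨ not (x <ᵇ hi)) + nearRegular k hi x ≡ nearRegular (suc k) lo x
cointerval-remove k {lo} {hi} lo≤hi x with x <ᵇ lo in x<lo | x <ᵇ hi in x<hi
... | true  | true  = refl
... | true  | false = contradiction (trans (sym (<ᵇ-mono lo≤hi x<lo)) x<hi) λ ()
... | false | true  = refl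
... | false | false = refl

-- The block is [p − d, p) if d ≤ p, and [0, p) ∪ [N − (d − p), N) otherwise.
removeBlock : ∀ N k p d → p ≤ N → d ≤ N → (k ≡ 0 → d ≤ p) →
  Σ ℕ λ k′ → Σ ℕ λ p′ → p′ ≤ N × Removal N (nearRegular k p) d (nearRegular k′ p′)
                         × (k′ ≡ k × d + p′ ≡ p ⊎ k ≡ suc k′ × p + N ≡ d + p′)
removeBlock N k p d p≤N d≤N k≡0⇒d≤p with d ≤? p
... | yes d≤p = k , p′ , ≤-trans p′≤p p≤N , R , inj₁ (refl , d+p′≡p)
  where
  open ≡-Reasoning
  p′ = p ∸ d
  p′≤p = m∸n≤m p d
  d+p′≡p = m+[n∸m]≡n d≤p
  R : Removal N (nearRegular k p) d (nearRegular k p′)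
  R = record
    { block      = λ x → (x <ᵇ p) ∧ not (x <ᵇ p′)
    ; block-size = +-cancelʳ-≡ p′ _ _ (begin
        count N (λ x → (x <ᵇ p) ∧ not (x <ᵇ p′)) + p′
          ≡⟨ cong (count N (λ x → (x <ᵇ p) ∧ not (x <ᵇ p′)) +_) (count<ᵇ N p′ (≤-trans p′≤p p≤N)) ⟨
        count N (λ x → (x <ᵇ p) ∧ not (x <ᵇ p′)) + count N (_<ᵇ p′)
          ≡⟨ count-∧-not N (λ x → <ᵇ-mono p′≤p) ⟩
        count N (_<ᵇ p) ≡⟨ count<ᵇ N p p≤N ⟩
        p               ≡⟨ d+p′≡p ⟨
        d + p′          ∎)
    ; remove     = interval-remove k p′≤p
    }
... | no d≰p with k
...   | zero   = ⊥-elim (d≰p (k≡0⇒d≤p refl))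
...   | suc k′ = k′ , p′ , p′≤N , R , inj₂ (refl , p+N≡d+p′)
  where
  open ≡-Reasoning
  u = d ∸ p
  p+u≡d : p + u ≡ d
  p+u≡d = m+[n∸m]≡n (<⇒≤ (≰⇒> d≰p))
  p′ = N ∸ u
  p′≤N = m∸n≤m N u
  p′+u≡N : p′ + u ≡ N
  p′+u≡N = m∸n+n≡m (≤-trans (m≤n+m u p) (≤-trans (≤-reflexive p+u≡d) d≤N))
  p+N≡d+p′ : p + N ≡ d + p′
  p+N≡d+p′ = begin
    p + N        ≡⟨ cong (p +_) (trans (sym p′+u≡N) (+-comm p′ u)) ⟩
    p + (u + p′) ≡⟨ +-assoc p u p′ ⟨
    p + u + p′   ≡⟨ cong (_+ p′) p+u≡d ⟩
    d + p′       ∎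
  p≤p′ : p ≤ p′
  p≤p′ = +-cancelʳ-≤ u p p′ (≤-trans (≤-reflexive p+u≡d) (≤-trans d≤N (≤-reflexive (sym p′+u≡N))))
  R : Removal N (nearRegular (suc k′) p) d (nearRegular k′ p′)
  R = record
    { block      = λ x → (x <ᵇ p) ∨ not (x <ᵇ p′)
    ; block-size = +-cancelʳ-≡ p′ _ _ (begin
        count N (λ x → (x <ᵇ p) ∨ not (x <ᵇ p′)) + p′
          ≡⟨ cong (count N (λ x → (x <ᵇ p) ∨ not (x <ᵇ p′)) +_) (count<ᵇ N p′ p′≤N) ⟨
        count N (λ x → (x <ᵇ p) ∨ not (x <ᵇ p′)) + count N (_<ᵇ p′)
          ≡⟨ count-∨-not N (λ x → <ᵇ-mono p≤p′) ⟩
        count N (_<ᵇ p) + N ≡⟨ cong (_+ N) (count<ᵇ N p p≤N) ⟩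
        p + N               ≡⟨ p+N≡d+p′ ⟩
        d + p′              ∎)
    ; remove     = cointerval-remove k′ p≤p′
    }

-- Graphs on the vertex set {0, …, N − 1}

-- Only the restriction of edge to {0, …, N − 1} matters.
record GraphOn (N : ℕ) (deg : ℕ → ℕ) : Set where
  field
    edge        : ℕ → ℕ → Bool
    edge-sym    : ∀ x y → edge x y ≡ edge y x
    edge-irrefl : ∀ x → edge x x ≡ false
    edge-degree : ∀ x → x < N → count N (edge x) ≡ deg x

open GraphOn public

GraphOn-cong : ∀ {N d d′} → (∀ x → x < N → d x ≡ d′ x) → GraphOn N d → GraphOn N d′
GraphOn-cong d≡d′ G = record
  { edge        = edge G
  ; edge-sym    = edge-sym G
  ; edge-irrefl = edge-irrefl G
  ; edge-degree = λ x x<N → trans (edge-degree G x x<N) (d≡d′ x x<N)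
  }

emptyGraph : ∀ N → GraphOn N (λ _ → 0)
emptyGraph N = record
  { edge        = λ _ _ → false
  ; edge-sym    = λ _ _ → refl
  ; edge-irrefl = λ _ → refl
  ; edge-degree = λ _ _ → trans (∑-const N 0) (*-zeroʳ N)
  }

addVertex : ∀ {N f g} → Removal N (f ∘ suc) (f 0) g → GraphOn N g → GraphOn (suc N) f
addVertex {N} {f} {g} R G = record
  { edge        = edge′
  ; edge-sym    = sym′
  ; edge-irrefl = λ { zero → refl ; (suc x) → edge-irrefl G x }
  ; edge-degree = λ { zero _ → block-size R
                    ; (suc x) (s<s x<N) → trans (cong (bit (block R x) +_) (edge-degree G x x<N)) (remove R x) }
  }
  where
  edge′ : ℕ → ℕ → Bool
  edge′ zero    zero    = false
  edge′ zero    (suc y) = block R y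
  edge′ (suc x) zero    = block R x
  edge′ (suc x) (suc y) = edge G x y
  sym′ : ∀ x y → edge′ x y ≡ edge′ y x
  sym′ zero    zero    = refl
  sym′ zero    (suc y) = refl
  sym′ (suc x) zero    = refl
  sym′ (suc x) (suc y) = edge-sym G x y

reverseGraph : ∀ {N d} → GraphOn N d → GraphOn N (λ x → d (N ∸ suc x))
reverseGraph {N} {d} G = record
  { edge        = λ x y → edge G (N ∸ suc x) (N ∸ suc y)
  ; edge-sym    = λ x y → edge-sym G (N ∸ suc x) (N ∸ suc y)
  ; edge-irrefl = λ x → edge-irrefl G (N ∸ suc x)
  ; edge-degree = λ x x<N → trans (∑-reverse N (bit ∘ edge G (N ∸ suc x)))
                                  (edge-degree G (N ∸ suc x) (∸-monoʳ-< z<s x<N))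
  }

peel-bound : ∀ N k p {k′ p′} → p ≤ suc N → nearRegular k p 0 ≤ N →
             (k′ ≡ k × nearRegular k p 0 + p′ ≡ pred p ⊎ k ≡ suc k′ × pred p + N ≡ nearRegular k p 0 + p′) →
             nearRegular k′ p′ 0 ≤ pred N
peel-bound N k zero {p′ = zero} _ _ (inj₁ (refl , k+0≡0)) =
  subst (_≤ pred N) (sym (m+n≡0⇒m≡0 k k+0≡0)) z≤n
peel-bound N k zero {p′ = suc _} _ _ (inj₁ (refl , k+p′≡0)) =
  contradiction (m+n≡0⇒n≡0 k k+p′≡0) λ ()
peel-bound N k (suc p) {p′ = zero} _ k<N (inj₁ (refl , _)) = pred-mono-≤ k<N
peel-bound N k (suc p) {p′ = suc p′} (s≤s p≤N) _ (inj₁ (refl , e)) =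
  pred-mono-≤ (≤-trans (m<m+n (suc k) z<s) (≤-trans (≤-reflexive e) p≤N))
peel-bound N k p {p′ = zero} _ d≤N (inj₂ (refl , _)) = pred-mono-≤ (≤-trans (k≤nearRegular k p 0) d≤N)
peel-bound N k zero {p′ = suc p′} _ _ (inj₂ (refl , e)) =
  pred-mono-≤ (≤-trans (m<m+n k z<s) (≤-reflexive (sym e)))
peel-bound N k (suc p) {p′ = suc p′} _ k<N (inj₂ (refl , _)) = pred-mono-≤ k<N

even-nearRegular₀-peel : ∀ N p → parity (N * 0 + p) ≡ 0ℙ → nearRegular 0 p 0 ≤ pred p
even-nearRegular₀-peel N zero          _    = z≤n
even-nearRegular₀-peel N (suc zero)    even =
  contradiction (trans (cong (λ t → parity (t + 1)) (sym (*-zeroʳ N))) even) λ ()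
even-nearRegular₀-peel N (suc (suc p)) _    = s≤s z≤n

-- Vertex 0 has maximum degree d₀ and is joined to a block of d₀ further vertices; the
-- degree sum drops by 2·d₀, so its parity is preserved.
nearRegularGraph : ∀ N k p → p ≤ N → parity (N * k + p) ≡ 0ℙ → nearRegular k p 0 ≤ pred N →
                   GraphOn N (nearRegular k p)
nearRegularGraph zero k p _ _ _ = record
  { edge = λ _ _ → false ; edge-sym = λ _ _ → refl ; edge-irrefl = λ _ → refl ; edge-degree = λ _ () }
nearRegularGraph (suc N) k p p≤1+N even d₀≤N
  with removeBlock N k (pred p) (nearRegular k p 0) (pred-mono-≤ p≤1+N) d₀≤N k≡0⇒d₀≤pred-p
  where
  k≡0⇒d₀≤pred-p : k ≡ 0 → nearRegular k p 0 ≤ pred p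
  k≡0⇒d₀≤pred-p refl = even-nearRegular₀-peel (suc N) p even
... | k′ , p′ , p′≤N , R , outcome =
  addVertex R′ (nearRegularGraph N k′ p′ p′≤N even′ (peel-bound N k p p≤1+N d₀≤N outcome))
  where
  open ≡-Reasoning
  d₀ = nearRegular k p 0
  R′ : Removal N (nearRegular k p ∘ suc) d₀ (nearRegular k′ p′)
  R′ = record { block = block R ; block-size = block-size R
              ; remove = λ x → trans (remove R x) (nearRegular-suc k p x) }
  total : suc N * k + p ≡ d₀ + d₀ + (N * k′ + p′)
  total = begin
    suc N * k + p                        ≡⟨ ∑-nearRegular (suc N) k p p≤1+N ⟨
    d₀ + ∑ N (nearRegular k p ∘ suc)     ≡⟨ cong (d₀ +_) (removal-∑ R′) ⟩
    d₀ + (d₀ + ∑ N (nearRegular k′ p′))  ≡⟨ +-assoc d₀ d₀ _ ⟨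
    d₀ + d₀ + ∑ N (nearRegular k′ p′)    ≡⟨ cong (d₀ + d₀ +_) (∑-nearRegular N k′ p′ p′≤N) ⟩
    d₀ + d₀ + (N * k′ + p′)              ∎
  even′ : parity (N * k′ + p′) ≡ 0ℙ
  even′ = trans (sym (parity-double+ d₀ _)) (trans (cong parity (sym total)) even)

-- Writing b = y + 1 + k, the profile b ∸ nearRegular y r is nearRegular k (m ∸ r) read
-- backwards; if y = b there are no edges at all.
graph-∸-nearRegular : ∀ m b y r T → 0 < m → r ≤ m → m * y + r + T ≡ m * b → parity T ≡ 0ℙ →
                      T + m ≤ m * m → GraphOn m (λ z → b ∸ nearRegular y r z)
graph-∸-nearRegular m b y r T 0<m r≤m total even T+m≤m*m with m≤n⇒∃[o]m+o≡n y≤b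
  where
  y≤b : y ≤ b
  y≤b = *-cancelˡ-≤ m {{>-nonZero 0<m}}
          (≤-trans (≤-trans (m≤m+n (m * y) r) (m≤m+n _ T)) (≤-reflexive total))
... | zero , refl = GraphOn-cong no-edges (emptyGraph m)
  where
  r≡0 : r ≡ 0
  r≡0 = m+n≡0⇒m≡0 r (+-cancelˡ-≡ (m * y) _ _
          (trans (sym (+-assoc (m * y) r T))
                 (trans total (trans (cong (m *_) (+-identityʳ y)) (sym (+-identityʳ _))))))
  no-edges : ∀ z → z < m → 0 ≡ (y + 0) ∸ nearRegular y r z
  no-edges z _ = sym (trans (cong (λ r → (y + 0) ∸ nearRegular y r z) r≡0) (m+n∸m≡n y 0))
... | suc k , refl =
  GraphOn-cong (λ z z<m → nearRegular-reverse m k y r z r≤m z<m)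
    (reverseGraph (nearRegularGraph m k (m ∸ r) (m∸n≤m m r)
      (subst (λ t → parity t ≡ 0ℙ) T≡ even)
      (nearRegular-max 0<m (subst (λ t → t + m ≤ m * m) T≡ T+m≤m*m))))
  where
  open ≡-Reasoning
  T≡ : T ≡ m * k + (m ∸ r)
  T≡ = +-cancelˡ-≡ r _ _ (begin
    r + T                ≡⟨ +-cancelˡ-≡ (m * y) _ _ (trans (sym (+-assoc (m * y) r T)) (trans total m*b≡)) ⟩
    m + m * k            ≡⟨ cong (_+ m * k) (m+[n∸m]≡n r≤m) ⟨
    r + (m ∸ r) + m * k  ≡⟨ +-assoc r (m ∸ r) (m * k) ⟩
    r + ((m ∸ r) + m * k) ≡⟨ cong (r +_) (+-comm (m ∸ r) (m * k)) ⟩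
    r + (m * k + (m ∸ r)) ∎)
    where
    m*b≡ : m * (y + suc k) ≡ m * y + (m + m * k)
    m*b≡ = trans (*-distribˡ-+ m y (suc k)) (cong (m * y +_) (*-suc m k))

record Bipartite (s m : ℕ) (row col : ℕ → ℕ) : Set where
  field
    link     : ℕ → ℕ → Bool
    link-row : ∀ x → x < s → count m (link x) ≡ row x
    link-col : ∀ z → z < m → count s (λ x → link x z) ≡ col z

open Bipartite public

bipartite-nearRegular : ∀ s m row y r → r ≤ m → (∀ x → x < s → row x ≤ m) →
                        ∑ s row ≡ ∑ m (nearRegular y r) → Bipartite s m row (nearRegular y r)
bipartite-nearRegular zero m row y r _ _ total = record
  { link     = λ _ _ → false
  ; link-row = λ _ ()
  ; link-col = λ z z<m → sym (∑≡0⇒≡0 m _ (sym total) z z<m)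
  }
bipartite-nearRegular (suc s) m row y r r≤m row≤m total
  with removeBlock m y r (row 0) r≤m (row≤m 0 z<s) y≡0⇒row₀≤r
  where
  y≡0⇒row₀≤r : y ≡ 0 → row 0 ≤ r
  y≡0⇒row₀≤r refl = begin
    row 0                      ≤⟨ m≤m+n (row 0) _ ⟩
    ∑ (suc s) row              ≡⟨ total ⟩
    ∑ m (nearRegular 0 r)      ≡⟨ ∑-nearRegular m 0 r r≤m ⟩
    m * 0 + r                  ≡⟨ cong (_+ r) (*-zeroʳ m) ⟩
    r                          ∎
    where open ≤-Reasoning
... | y′ , r′ , r′≤m , R , _ = record
  { link     = link′
  ; link-row = λ { zero _ → block-size R ; (suc x) (s<s x<s) → link-row B x x<s }
  ; link-col = λ z z<m → trans (cong (bit (block R z) +_) (link-col B z z<m)) (remove R z)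
  }
  where
  B = bipartite-nearRegular s m (row ∘ suc) y′ r′ r′≤m (λ x x<s → row≤m (suc x) (s<s x<s))
        (+-cancelˡ-≡ (row 0) _ _ (trans total (removal-∑ R)))
  link′ : ℕ → ℕ → Bool
  link′ zero    = block R
  link′ (suc x) = link B x

joinEdges : ℕ → (ℕ → ℕ → Bool) → (ℕ → ℕ → Bool) → (ℕ → ℕ → Bool) → ℕ → ℕ → Bool
joinEdges s ES ET L x y = if x <ᵇ s then (if y <ᵇ s then ES x y else L x (y ∸ s))
                                    else (if y <ᵇ s then L y (x ∸ s) else ET (x ∸ s) (y ∸ s))

count-joinEdges-left : ∀ s m ES ET L {x} → x < s →
                       count (s + m) (joinEdges s ES ET L x) ≡ count s (ES x) + count m (L x)
count-joinEdges-left s m ES ET L {x} x<s =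
  trans (∑-++ s m _) (cong₂ _+_ (count-cong s (λ y y<s → left y<s)) (count-cong m (λ z _ → right z)))
  where
  left : ∀ {y} → y < s → joinEdges s ES ET L x y ≡ ES x y
  left y<s rewrite <ᵇ-true x<s | <ᵇ-true y<s = refl
  right : ∀ z → joinEdges s ES ET L x (s + z) ≡ L x z
  right z rewrite <ᵇ-true x<s | <ᵇ-false {s + z} (m≤m+n s z) | m+n∸m≡n s z = refl

count-joinEdges-right : ∀ s m ES ET L {x} → s ≤ x →
                        count (s + m) (joinEdges s ES ET L x) ≡ count s (λ y → L y (x ∸ s)) + count m (ET (x ∸ s))
count-joinEdges-right s m ES ET L {x} s≤x =
  trans (∑-++ s m _) (cong₂ _+_ (count-cong s (λ y y<s → left y<s)) (count-cong m (λ z _ → right z)))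
  where
  left : ∀ {y} → y < s → joinEdges s ES ET L x y ≡ L y (x ∸ s)
  left y<s rewrite <ᵇ-false s≤x | <ᵇ-true y<s = refl
  right : ∀ z → joinEdges s ES ET L x (s + z) ≡ ET (x ∸ s) z
  right z rewrite <ᵇ-false s≤x | <ᵇ-false {s + z} (m≤m+n s z) | m+n∸m≡n s z = refl

joinGraph : ∀ {s m dS dT row col} → GraphOn s dS → GraphOn m dT → Bipartite s m row col →
            GraphOn (s + m) (λ x → if x <ᵇ s then dS x + row x else col (x ∸ s) + dT (x ∸ s))
joinGraph {s} {m} {dS} {dT} {row} {col} GS GT B = record
  { edge        = E
  ; edge-sym    = E-sym
  ; edge-irrefl = E-irrefl
  ; edge-degree = E-degree
  }
  where
  E = joinEdges s (edge GS) (edge GT) (link B)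
  E-sym : ∀ x y → E x y ≡ E y x
  E-sym x y with x <ᵇ s | y <ᵇ s
  ... | true  | true  = edge-sym GS x y
  ... | true  | false = refl
  ... | false | true  = refl
  ... | false | false = edge-sym GT (x ∸ s) (y ∸ s)
  E-irrefl : ∀ x → E x x ≡ false
  E-irrefl x with x <ᵇ s
  ... | true  = edge-irrefl GS x
  ... | false = edge-irrefl GT (x ∸ s)
  E-degree : ∀ x → x < s + m →
             count (s + m) (E x) ≡ (if x <ᵇ s then dS x + row x else col (x ∸ s) + dT (x ∸ s))
  E-degree x x<s+m with x <? s
  ... | yes x<s =
    trans (count-joinEdges-left s m (edge GS) (edge GT) (link B) x<s)
      (trans (cong₂ _+_ (edge-degree GS x x<s) (link-row B x x<s))
             (cong (if_then dS x + row x else col (x ∸ s) + dT (x ∸ s)) (sym (<ᵇ-true x<s))))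
  ... | no x≮s =
    trans (count-joinEdges-right s m (edge GS) (edge GT) (link B) (≮⇒≥ x≮s))
      (trans (cong₂ _+_ (link-col B (x ∸ s) x∸s<m) (edge-degree GT (x ∸ s) x∸s<m))
             (cong (if_then dS x + row x else col (x ∸ s) + dT (x ∸ s)) (sym (<ᵇ-false (≮⇒≥ x≮s)))))
    where
    x∸s<m : x ∸ s < m
    x∸s<m = +-cancelˡ-< s (x ∸ s) m (subst (_< s + m) (sym (m+[n∸m]≡n (≮⇒≥ x≮s))) x<s+m)

-- Splitting the degree sums between and inside the two blocks

-- cross edges run between the blocks of sizes s and m; degS and degT are the degree sums
-- inside the two blocks.
record EdgeSplit (s m a b : ℕ) : Set where
  field
    cross degS degT : ℕ
    cross+degS : cross + degS ≡ s * a
    cross+degT : cross + degT ≡ m * b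
    degS-even  : parity degS ≡ 0ℙ
    degT-even  : parity degT ≡ 0ℙ
    degS-bound : degS + s ≤ s * s
    degT-bound : degT + m ≤ m * m
    cross≤     : cross ≤ s * m

EdgeSplit⇒graph : ∀ {s m a b} → 0 < s → 0 < m → EdgeSplit s m a b →
                  GraphOn (s + m) (λ x → if x <ᵇ s then a else b)
EdgeSplit⇒graph {s} {m} {a} {b} 0<s 0<m σ
  with division s (EdgeSplit.degS σ) 0<s | division m (EdgeSplit.cross σ) 0<m
... | kS , pS , pS<s , refl | y , r , r<m , refl = GraphOn-cong degrees (joinGraph GS GT B)
  where
  open EdgeSplit σ
  dS = nearRegular kS pS
  row = λ x → a ∸ dS x
  dS≤a : ∀ x → dS x ≤ a
  dS≤a = nearRegular-≤ 0<s (≤-trans (m≤n+m _ cross) (≤-reflexive cross+degS))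
  col≤b : ∀ z → nearRegular y r z ≤ b
  col≤b = nearRegular-≤ 0<m (≤-trans (m≤m+n _ degT) (≤-reflexive cross+degT))
  row≤m : ∀ x → x < s → row x ≤ m
  row≤m x _ = ∸nearRegular-≤ pS<s (≤-trans (≤-reflexive (sym cross+degS)) (+-monoˡ-≤ _ cross≤)) x
  ∑row≡cross : ∑ s row ≡ ∑ m (nearRegular y r)
  ∑row≡cross = +-cancelʳ-≡ degS _ _ (begin
    ∑ s row + degS               ≡⟨ cong (∑ s row +_) (∑-nearRegular s kS pS (<⇒≤ pS<s)) ⟨
    ∑ s row + ∑ s dS             ≡⟨ ∑-∸ s a dS (λ x _ → dS≤a x) ⟩
    s * a                        ≡⟨ cross+degS ⟨
    cross + degS                 ≡⟨ cong (_+ degS) (∑-nearRegular m y r (<⇒≤ r<m)) ⟨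
    ∑ m (nearRegular y r) + degS ∎)
    where open ≡-Reasoning
  GS = nearRegularGraph s kS pS (<⇒≤ pS<s) degS-even (nearRegular-max 0<s degS-bound)
  B = bipartite-nearRegular s m row y r (<⇒≤ r<m) row≤m ∑row≡cross
  GT = graph-∸-nearRegular m b y r degT 0<m (<⇒≤ r<m) cross+degT degT-even degT-bound
  degrees : ∀ x → x < s + m →
            (if x <ᵇ s then dS x + row x else nearRegular y r (x ∸ s) + (b ∸ nearRegular y r (x ∸ s)))
            ≡ (if x <ᵇ s then a else b)
  degrees x _ with x <ᵇ s
  ... | true  = m+[n∸m]≡n (dS≤a x)
  ... | false = m+[n∸m]≡n (col≤b (x ∸ s))

even-complement : ∀ c T x → c + T ≡ x → parity (c + x) ≡ 0ℙ → parity T ≡ 0ℙ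
even-complement c T x c+T≡x even =
  trans (sym (parity-double+ c T)) (trans (cong parity (trans (+-assoc c c T) (cong (c +_) c+T≡x))) even)

below-square : ∀ N k → k < N → N * k + N ≤ N * N
below-square N k k<N = ≤-trans (≤-reflexive (trans (+-comm (N * k) N) (sym (*-suc N k)))) (*-monoʳ-≤ N k<N)

-- N·k is odd, so k ≠ N − 1 because N(N − 1) is even.
odd-below-square : ∀ N k → k < N → parity (N * k) ≡ 1ℙ → N * k + 1 + N ≤ N * N
odd-below-square N k k<N odd with suc k <? N
... | no k+1≮N =
  contradiction (trans (sym odd) (trans (cong (λ M → parity (M * k)) N≡k+1) (parity-suc*self k))) λ ()
  where
  N≡k+1 : N ≡ suc k
  N≡k+1 = sym (≤-antisym k<N (≮⇒≥ k+1≮N))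
... | yes k+1<N = begin
  N * k + 1 + N   ≤⟨ +-monoˡ-≤ N (+-monoʳ-≤ (N * k) (m<n⇒0<n k<N)) ⟩
  N * k + N + N   ≡⟨ cong (_+ N) (trans (+-comm (N * k) N) (sym (*-suc N k))) ⟩
  N * suc k + N   ≤⟨ below-square N (suc k) k+1<N ⟩
  N * N           ∎
  where open ≤-Reasoning

edgeSplit-emptyS : ∀ {s m a b} → 0 < s → b < a → a ≤ m → s * a ≤ m * b → parity (s * a + m * b) ≡ 0ℙ →
                   EdgeSplit s m a b
edgeSplit-emptyS {s} {m} {a} {b} 0<s b<a a≤m sa≤mb even = record
  { cross      = s * a
  ; degS       = 0
  ; degT       = T
  ; cross+degS = +-identityʳ (s * a)
  ; cross+degT = sa+T≡mb
  ; degS-even  = refl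
  ; degT-even  = even-complement (s * a) T (m * b) sa+T≡mb even
  ; degS-bound = m≤m*n s s {{>-nonZero 0<s}}
  ; degT-bound = ≤-trans (+-monoˡ-≤ m (≤-trans (m≤n+m T (s * a)) (≤-reflexive sa+T≡mb)))
                         (below-square m b (<-≤-trans b<a a≤m))
  ; cross≤     = *-monoʳ-≤ s a≤m
  }
  where
  T = proj₁ (m≤n⇒∃[o]m+o≡n sa≤mb)
  sa+T≡mb = proj₂ (m≤n⇒∃[o]m+o≡n sa≤mb)

edgeSplit-emptyT : ∀ {s m a b} → 0 < m → b ≤ s → m * b ≤ s * a → parity (s * a + m * b) ≡ 0ℙ →
                   s * a + s ≤ s * s + m * b → EdgeSplit s m a b
edgeSplit-emptyT {s} {m} {a} {b} 0<m b≤s mb≤sa even sa+s≤ss+mb = record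
  { cross      = m * b
  ; degS       = T
  ; degT       = 0
  ; cross+degS = mb+T≡sa
  ; cross+degT = +-identityʳ (m * b)
  ; degS-even  = even-complement (m * b) T (s * a) mb+T≡sa (trans (cong parity (+-comm (m * b) (s * a))) even)
  ; degT-even  = refl
  ; degS-bound = +-cancelˡ-≤ (m * b) _ _ (begin
      m * b + (T + s) ≡⟨ +-assoc (m * b) T s ⟨
      m * b + T + s   ≡⟨ cong (_+ s) mb+T≡sa ⟩
      s * a + s       ≤⟨ sa+s≤ss+mb ⟩
      s * s + m * b   ≡⟨ +-comm (s * s) (m * b) ⟩
      m * b + s * s   ∎)
  ; degT-bound = m≤m*n m m {{>-nonZero 0<m}}
  ; cross≤     = ≤-trans (*-monoʳ-≤ m b≤s) (≤-reflexive (*-comm m s))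
  }
  where
  open ≤-Reasoning
  T = proj₁ (m≤n⇒∃[o]m+o≡n mb≤sa)
  mb+T≡sa = proj₂ (m≤n⇒∃[o]m+o≡n mb≤sa)

edgeSplit-fullCross : ∀ {s m a b} → 0 < s → 0 < m → m < a → s < b → b < a → a < s + m →
                      parity (s * a + m * b) ≡ 0ℙ → EdgeSplit s m a b
edgeSplit-fullCross {s} {m} {a} {b} 0<s 0<m m<a s<b b<a a<s+m even
  with m≤n⇒∃[o]m+o≡n (<⇒≤ m<a) | m≤n⇒∃[o]m+o≡n (<⇒≤ s<b)
... | α , refl | β , refl = split (parity (s * α)) refl
  where
  α<s : α < s
  α<s = +-cancelˡ-< m α s (<-≤-trans a<s+m (≤-reflexive (+-comm s m)))
  β<m : β < m
  β<m = +-cancelˡ-< s β m (<-trans b<a a<s+m)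
  parity-mβ : parity (m * β) ≡ parity (s * α)
  parity-mβ = even-sum⇒parity≡ (s * α) (m * β)
    (trans (sym (parity-double+ (s * m) (s * α + m * β))) (trans (cong parity regroup) even))
    where
    regroup : s * m + s * m + (s * α + m * β) ≡ s * (m + α) + m * (s + β)
    regroup = solve (s ∷ m ∷ α ∷ β ∷ [])
  split : ∀ p → parity (s * α) ≡ p → EdgeSplit s m (m + α) (s + β)
  split 0ℙ even-sα = record
    { cross      = s * m
    ; degS       = s * α
    ; degT       = m * β
    ; cross+degS = sym (*-distribˡ-+ s m α)
    ; cross+degT = trans (cong (_+ m * β) (*-comm s m)) (sym (*-distribˡ-+ m s β))
    ; degS-even  = even-sα
    ; degT-even  = trans parity-mβ even-sα
    ; degS-bound = below-square s α α<s
    ; degT-bound = below-square m β β<m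
    ; cross≤     = ≤-refl
    }
  split 1ℙ odd-sα = record
    { cross      = c
    ; degS       = s * α + 1
    ; degT       = m * β + 1
    ; cross+degS = begin
        c + (s * α + 1) ≡⟨ trans (cong (c +_) (+-comm (s * α) 1)) (+-suc c (s * α)) ⟩
        1 + c + s * α   ≡⟨ cong (_+ s * α) 1+c≡sm ⟩
        s * m + s * α   ≡⟨ *-distribˡ-+ s m α ⟨
        s * (m + α)     ∎
    ; cross+degT = begin
        c + (m * β + 1) ≡⟨ trans (cong (c +_) (+-comm (m * β) 1)) (+-suc c (m * β)) ⟩
        1 + c + m * β   ≡⟨ cong (_+ m * β) (trans 1+c≡sm (*-comm s m)) ⟩
        m * s + m * β   ≡⟨ *-distribˡ-+ m s β ⟨
        m * (s + β)     ∎
    ; degS-even  = parity-odd+1 (s * α) odd-sα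
    ; degT-even  = parity-odd+1 (m * β) (trans parity-mβ odd-sα)
    ; degS-bound = odd-below-square s α α<s odd-sα
    ; degT-bound = odd-below-square m β β<m (trans parity-mβ odd-sα)
    ; cross≤     = ≤-trans (n≤1+n c) (≤-reflexive 1+c≡sm)
    }
    where
    open ≡-Reasoning
    c = proj₁ (m≤n⇒∃[o]m+o≡n (*-mono-≤ 0<s 0<m))
    1+c≡sm : 1 + c ≡ s * m
    1+c≡sm = proj₂ (m≤n⇒∃[o]m+o≡n (*-mono-≤ 0<s 0<m))

edgeSplit : ∀ {s m a b} → 0 < s → 0 < m → b < a → a < s + m → parity (s * a + m * b) ≡ 0ℙ →
            s * a + s ≤ s * s + m * b → EdgeSplit s m a b
edgeSplit {s} {m} {a} {b} 0<s 0<m b<a a<s+m even bound with s * a ≤? m * b | m <? a | s <? b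
... | yes sa≤mb | no m≮a  | _        = edgeSplit-emptyS 0<s b<a (≮⇒≥ m≮a) sa≤mb even
... | no sa≰mb  | _       | no s≮b   = edgeSplit-emptyT 0<m (≮⇒≥ s≮b) (<⇒≤ (≰⇒> sa≰mb)) even bound
... | _         | yes m<a | yes s<b  = edgeSplit-fullCross 0<s 0<m m<a s<b b<a a<s+m even
... | yes sa≤mb | yes m<a | no s≮b   = ⊥-elim (<-irrefl refl (begin-strict
  m * b ≤⟨ *-monoʳ-≤ m (≮⇒≥ s≮b) ⟩
  m * s ≡⟨ *-comm m s ⟩
  s * m <⟨ *-monoʳ-< s {{>-nonZero 0<s}} m<a ⟩
  s * a ≤⟨ sa≤mb ⟩
  m * b ∎))
  where open ≤-Reasoning
... | no sa≰mb  | no m≮a  | yes s<b  = ⊥-elim (<-irrefl refl (begin-strict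
  s * a ≤⟨ *-monoʳ-≤ s (≮⇒≥ m≮a) ⟩
  s * m ≡⟨ *-comm s m ⟩
  m * s <⟨ *-monoʳ-< m {{>-nonZero 0<m}} s<b ⟩
  m * b <⟨ ≰⇒> sa≰mb ⟩
  s * a ∎))
  where open ≤-Reasoning

-- Necessity

first-block-degree-bound : ∀ s m (E : ℕ → ℕ → Bool) →
  (∀ x y → x < s + m → y < s + m → E x y ≡ E y x) → (∀ x → x < s + m → E x x ≡ false) →
  ∑ s (λ x → count (s + m) (E x)) + s ≤ s * s + ∑ m (λ z → count (s + m) (E (s + z)))
first-block-degree-bound s m E E-sym E-irrefl = begin
  ∑ s (λ x → count (s + m) (E x)) + s
    ≡⟨ cong (∑ s (λ x → count (s + m) (E x)) +_) (trans (sym (*-identityʳ s)) (sym (∑-const s 1))) ⟩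
  ∑ s (λ x → count (s + m) (E x)) + ∑ s (λ _ → 1)   ≡⟨ ∑-distrib-+ s _ _ ⟨
  ∑ s (λ x → count (s + m) (E x) + 1)               ≤⟨ ∑-mono-≤ s inside+1≤ ⟩
  ∑ s (λ x → s + toT x)                             ≡⟨ ∑-distrib-+ s _ toT ⟩
  ∑ s (λ _ → s) + ∑ s toT                           ≡⟨ cong₂ _+_ (∑-const s s) (∑-comm s m (λ x z → bit (E x (s + z)))) ⟩
  s * s + ∑ m (λ z → ∑ s (λ x → bit (E x (s + z)))) ≤⟨ +-monoʳ-≤ (s * s) (∑-mono-≤ m fromS≤) ⟩
  s * s + ∑ m (λ z → count (s + m) (E (s + z)))     ∎
  where
  open ≤-Reasoning
  inS : ∀ {x} → x < s → x < s + m
  inS = m≤n⇒m≤n+o m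
  toT : ℕ → ℕ
  toT x = count m (λ z → E x (s + z))
  inside+1≤ : ∀ x → x < s → count (s + m) (E x) + 1 ≤ s + toT x
  inside+1≤ x x<s = begin
    count (s + m) (E x) + 1     ≡⟨ cong (_+ 1) (∑-++ s m (bit ∘ E x)) ⟩
    count s (E x) + toT x + 1   ≡⟨ +-assoc (count s (E x)) _ 1 ⟩
    count s (E x) + (toT x + 1) ≡⟨ cong (count s (E x) +_) (+-comm (toT x) 1) ⟩
    count s (E x) + suc (toT x) ≡⟨ +-suc (count s (E x)) (toT x) ⟩
    suc (count s (E x)) + toT x ≤⟨ +-monoˡ-≤ (toT x) (count<-gap s (E x) x x<s (E-irrefl x (inS x<s))) ⟩
    s + toT x                   ∎
  fromS≤ : ∀ z → z < m → ∑ s (λ x → bit (E x (s + z))) ≤ count (s + m) (E (s + z))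
  fromS≤ z z<m = begin
    count s (λ x → E x (s + z))
      ≡⟨ count-cong s (λ x x<s → E-sym x (s + z) (inS x<s) (+-monoʳ-< s z<m)) ⟩
    count s (E (s + z))
      ≤⟨ m≤m+n _ _ ⟩
    count s (E (s + z)) + count m (λ w → E (s + z) (s + w))
      ≡⟨ ∑-++ s m (bit ∘ E (s + z)) ⟨
    count (s + m) (E (s + z))
      ∎

extend : ∀ {N} → (Fin N → Bool) → ℕ → Bool
extend {zero}  F _       = false
extend {suc N} F zero    = F fzero
extend {suc N} F (suc x) = extend (F ∘ fsuc) x

extend-toℕ : ∀ {N} (F : Fin N → Bool) i → extend F (toℕ i) ≡ F i
extend-toℕ F fzero    = refl
extend-toℕ F (fsuc i) = extend-toℕ (F ∘ fsuc) i

extend-∘toℕ : ∀ N (f : ℕ → Bool) x → x < N → extend {N} (f ∘ toℕ) x ≡ f x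
extend-∘toℕ (suc N) f zero    _         = refl
extend-∘toℕ (suc N) f (suc x) (s<s x<N) = extend-∘toℕ N (f ∘ suc) x x<N

length-filter-tabulate : ∀ {A : Set} N (g : Fin N → A) (P : A → Bool) →
                         length (filter (T? ∘ P) (tabulate g)) ≡ count N (extend (P ∘ g))
length-filter-tabulate zero    g P = refl
length-filter-tabulate (suc N) g P with P (g fzero)
... | true  = cong suc (length-filter-tabulate N (g ∘ fsuc) P)
... | false = length-filter-tabulate N (g ∘ fsuc) P

degree≡count : ∀ {N} (G : SimpleGraph N) i → degree G i ≡ count N (extend (adj G i))
degree≡count {N} G i = length-filter-tabulate N id (adj G i)

lookup-twoValued : ∀ (a b s m : ℕ) (i : Fin (s + m)) →
                   lookup (replicate s a ++ replicate m b) i ≡ (if toℕ i <ᵇ s then a else b)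
lookup-twoValued a b zero    m i        = lookup-replicate i b
lookup-twoValued a b (suc s) m fzero    = refl
lookup-twoValued a b (suc s) m (fsuc i) = lookup-twoValued a b s m i

GraphOn⇒Graphic : ∀ {N d} (v : Vec ℕ N) → (∀ i → d (toℕ i) ≡ lookup v i) → GraphOn N d → Graphic v
GraphOn⇒Graphic {N} {d} v d≡v G = H , degree-H
  where
  H : SimpleGraph N
  H = record { adj    = λ i j → edge G (toℕ i) (toℕ j)
             ; symm   = λ i j → edge-sym G (toℕ i) (toℕ j)
             ; irrefl = λ i → edge-irrefl G (toℕ i) }
  degree-H : ∀ i → degree H i ≡ lookup v i
  degree-H i = trans (degree≡count H i)
    (trans (count-cong N (λ y y<N → extend-∘toℕ N (edge G (toℕ i)) y y<N))
      (trans (edge-degree G (toℕ i) (toℕ<n i)) (d≡v i)))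

toRelation : ∀ {N} → SimpleGraph N → ℕ → ℕ → Bool
toRelation G x y = extend (λ i → extend (adj G i) y) x

toRelation-toℕ : ∀ {N} (G : SimpleGraph N) i y → toRelation G (toℕ i) y ≡ extend (adj G i) y
toRelation-toℕ G i y = extend-toℕ (λ i → extend (adj G i) y) i

toRelation-toℕ² : ∀ {N} (G : SimpleGraph N) i j → toRelation G (toℕ i) (toℕ j) ≡ adj G i j
toRelation-toℕ² G i j = trans (toRelation-toℕ G i (toℕ j)) (extend-toℕ (adj G i) j)

graphic⇒first-block-bound : ∀ s m a b → Graphic (replicate s a ++ replicate m b) → s * a + s ≤ s * s + m * b
graphic⇒first-block-bound s m a b (G , degree-G) = begin
  s * a + s                                     ≡⟨ cong (_+ s) first-block ⟨
  ∑ s (λ x → count (s + m) (R x)) + s           ≤⟨ first-block-degree-bound s m R R-sym R-irrefl ⟩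
  s * s + ∑ m (λ z → count (s + m) (R (s + z))) ≡⟨ cong (s * s +_) second-block ⟩
  s * s + m * b                                 ∎
  where
  open ≤-Reasoning
  R = toRelation G
  R-sym : ∀ x y → x < s + m → y < s + m → R x y ≡ R y x
  R-sym x y x<N y<N with fromℕ< x<N | toℕ-fromℕ< x<N | fromℕ< y<N | toℕ-fromℕ< y<N
  ... | i | refl | j | refl = trans (toRelation-toℕ² G i j) (trans (symm G i j) (sym (toRelation-toℕ² G j i)))
  R-irrefl : ∀ x → x < s + m → R x x ≡ false
  R-irrefl x x<N with fromℕ< x<N | toℕ-fromℕ< x<N
  ... | i | refl = trans (toRelation-toℕ² G i i) (irrefl G i)
  R-degree : ∀ x → x < s + m → count (s + m) (R x) ≡ (if x <ᵇ s then a else b)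
  R-degree x x<N with fromℕ< x<N | toℕ-fromℕ< x<N
  ... | i | refl = trans (count-cong (s + m) (λ y _ → toRelation-toℕ G i y))
                     (trans (sym (degree≡count G i)) (trans (degree-G i) (lookup-twoValued a b s m i)))
  first-block : ∑ s (λ x → count (s + m) (R x)) ≡ s * a
  first-block = trans (∑-cong s (λ x x<s → trans (R-degree x (m≤n⇒m≤n+o m x<s))
                                                  (cong (if_then a else b) (<ᵇ-true x<s))))
                      (∑-const s a)
  second-block : ∑ m (λ z → count (s + m) (R (s + z))) ≡ m * b
  second-block = trans (∑-cong m (λ z z<m → trans (R-degree (s + z) (+-monoʳ-< s z<m))
                                                   (cong (if_then a else b) (<ᵇ-false (m≤m+n s z)))))
                       (∑-const m b)

rearranged-condition : ∀ a b s m → ((1 + a + b) * s ≤ s * s + (s + m) * b) ⇔ (s * a + s ≤ s * s + m * b)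
rearranged-condition a b s m = mk⇔
  (λ h → +-cancelʳ-≤ (b * s) _ _ (subst₂ _≤_ lhs rhs h))
  (λ h → subst₂ _≤_ (sym lhs) (sym rhs) (+-monoˡ-≤ (b * s) h))
  where
  lhs : (1 + a + b) * s ≡ s * a + s + b * s
  lhs = solve (a ∷ b ∷ s ∷ [])
  rhs : s * s + (s + m) * b ≡ s * s + m * b + b * s
  rhs = solve (s ∷ m ∷ b ∷ [])

theorem3 : (a b n s : ℕ) → b < a → a < n → 0 < s → s < n →
           2 ∣ (a * s + b * (n ∸ s)) →
           (Graphic (twoValued a b s n) → (1 + a + b) * s ≤ s * s + n * b)
           × ((1 + a + b) * s ≤ s * s + n * b → Graphic (twoValued a b s n))
theorem3 a b n s b<a a<n 0<s s<n 2∣sum = necessary , sufficient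
  where
  m = n ∸ s
  condition : ((1 + a + b) * s ≤ s * s + n * b) ⇔ (s * a + s ≤ s * s + m * b)
  condition = subst (λ k → ((1 + a + b) * s ≤ s * s + k * b) ⇔ (s * a + s ≤ s * s + m * b))
                    (m+[n∸m]≡n (<⇒≤ s<n)) (rearranged-condition a b s m)
  even : parity (s * a + m * b) ≡ 0ℙ
  even = trans (cong₂ (λ x y → parity (x + y)) (*-comm s a) (*-comm m b)) (2∣⇒parity≡0ℙ 2∣sum)
  necessary : Graphic (twoValued a b s n) → (1 + a + b) * s ≤ s * s + n * b
  necessary G = Equivalence.from condition (graphic⇒first-block-bound s m a b G)
  sufficient : (1 + a + b) * s ≤ s * s + n * b → Graphic (twoValued a b s n)
  sufficient c = GraphOn⇒Graphic (twoValued a b s n) (λ i → sym (lookup-twoValued a b s m i))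
    (EdgeSplit⇒graph 0<s 0<m (edgeSplit 0<s 0<m b<a a<s+m even (Equivalence.to condition c)))
    where
    0<m : 0 < m
    0<m = m<n⇒0<n∸m s<n
    a<s+m : a < s + m
    a<s+m = <-≤-trans a<n (≤-reflexive (sym (m+[n∸m]≡n (<⇒≤ s<n))))
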